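{- Let $n\ge 1$, let $P_{n+1}$ be the path with vertices $v_0,\dots,v_n$ and edges $v_iv_{i+1}$, let $w:\{v_0,\dots,v_n\}\to\mathbb{N}$ be a weight function, and let $L^c$ be a waterfall list of $P_{n+1}$ such that $|L^c(i)|\ge w(i)+w(i+1)$ for every $i$ with $1\le i\le n-1$, and $|L^c(n)|\ge w(n)$. Then $P_{n+1}$ is $(L^c,w)$-colorable if and only if for all $j\in\{0,\dots,n\}$, $$\Big|\bigcup_{k=0}^{j}L^c(k)\Big|\ \ge\ \sum_{k=0}^{j}w(k).$$
   Context: A list $L$ assigns to each vertex a finite subset of $\mathbb{N}$; write $L(i)=L(v_i)$, $w(i)=w(v_i)$. An $(L,w)$-coloring is a map $c$ with $c(v)\subseteq L(v)$, $|c(v)|=w(v)$ for each vertex $v$, and $c(v)\cap c(v')=\emptyset$ for each edge $vv'$; the graph is $(L,w)$-colorable if one exists. A list $L$ of $P_{n+1}$ is a waterfall list if $L(i)\cap L(j)=\emptyset$ whenever $|i-j|\ge 2$. -}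

module Defs where

open import Data.Nat using (ℕ; suc; _≤_; _≤?_; ∣_-_∣; _+_)
open import Data.Nat.Properties using (_≟_)
open import Data.Fin using (Fin; toℕ; inject₁; fromℕ)
open import Data.List using (List; length; deduplicate; concat; map; filter; allFin)
open import Data.Nat.ListAction using (sum)
open import Relation.Binary.PropositionalEquality using (_≡_)
open import Data.List.Membership.Propositional using (_∈_)
open import Data.Empty using (⊥)
open import Data.Product using (Σ; _×_)

-- Finite subsets of ℕ are represented by lists (duplicates allowed,
-- order irrelevant); the cardinality is the number of distinct entries.
FinSet : Set
FinSet = List ℕ

card : FinSet → ℕ
card S = length (deduplicate _≟_ S)

_⊆ₛ_ : FinSet → FinSet → Set
A ⊆ₛ B = ∀ x → x ∈ A → x ∈ B

Disjoint : FinSet → FinSet → Set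
Disjoint A B = ∀ x → x ∈ A → x ∈ B → ⊥

-- Path P_{n+1}: vertices v_0..v_n indexed by Fin (suc n), edges v_i v_{i+1}.
-- A list assigns a finite subset of ℕ to each vertex; w is a weight function.
Lists : ℕ → Set
Lists n = Fin (suc n) → FinSet

Weights : ℕ → Set
Weights n = Fin (suc n) → ℕ

IsColoring : (n : ℕ) → Lists n → Weights n → (Fin (suc n) → FinSet) → Set
IsColoring n L w c =
  (∀ v → c v ⊆ₛ L v) ×
  (∀ v → card (c v) ≡ w v) ×
  (∀ (i : Fin n) → Disjoint (c (inject₁ i)) (c (Data.Fin.suc i)))

Colorable : (n : ℕ) → Lists n → Weights n → Set
Colorable n L w = Σ (Fin (suc n) → FinSet) (IsColoring n L w)

Waterfall : (n : ℕ) → Lists n → Set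
Waterfall n L = ∀ (i j : Fin (suc n)) → 2 ≤ ∣ toℕ i - toℕ j ∣ → Disjoint (L i) (L j)

upToV : (n : ℕ) → Fin (suc n) → List (Fin (suc n))
upToV n j = filter (λ k → toℕ k ≤? toℕ j) (allFin (suc n))

prefixUnion : (n : ℕ) → Lists n → Fin (suc n) → FinSet
prefixUnion n L j = concat (map L (upToV n j))

prefixWeight : (n : ℕ) → Weights n → Fin (suc n) → ℕ
prefixWeight n w j = sum (map w (upToV n j))

-- Necessity: the colour classes of v_0, …, v_j are pairwise disjoint (adjacent ones because c is
-- a colouring, the others because a waterfall list makes their lists disjoint), and they lie in
-- L(0) ∪ … ∪ L(j), which therefore has at least w(0) + … + w(j) elements.
--
-- Sufficiency, by induction on n: colour v_n first, preferring the fresh colours L(n) ∖ L(n-1),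
-- which by the waterfall property occur in no earlier list, and using shared colours of
-- L(n) ∩ L(n-1) only once the fresh ones are exhausted; then delete the chosen colours from all
-- lists and colour the shorter path. Fresh colours leave ⋃_{k<n} L(k) untouched, each shared
-- colour shrinks it by at most one, and the prefix condition at n pays for that; so the prefix conditions
-- survive. The bound |L(n-1)| ≥ w(n-1) + w(n) leaves v_{n-1} enough colours (for n = 1 the prefix
-- condition at 0 does).

module Submission where

open import Defs
open import Data.Nat using (ℕ; zero; suc; _≤_; _<_; _+_; _∸_; z≤n; s≤s; ∣_-_∣)
open import Data.Nat.Properties
open import Data.Nat.DivMod using (_mod_; m≤n⇒m%n≡m)
open import Data.Nat.ListAction using (sum)
open import Data.Nat.ListAction.Properties using (sum-++)
open import Data.Fin using (Fin; toℕ; inject₁; fromℕ; fromℕ<)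
open import Data.Fin.Properties using (toℕ-injective; toℕ<n; toℕ≤pred[n]; toℕ-fromℕ; toℕ-inject₁; toℕ-fromℕ<)
open import Data.List using (List; []; _∷_; _++_; [_]; length; deduplicate; map; filter; take; drop; allFin; upTo)
open import Data.List.Properties
  using (map-++; map-∘; map-cong; length-++; length-take; take++drop≡id; ++-identityʳ; upTo-∷ʳ)
open import Data.List.Membership.Propositional using (_∈_; _∉_)
open import Data.List.Membership.Propositional.Properties
  using (∈-∃++; ∈-++⁻; ∈-++⁺ˡ; ∈-++⁺ʳ; ∈-deduplicate⁻; ∈-deduplicate⁺; ∈-filter⁺; ∈-filter⁻;
         ∈-allFin; ∈-map⁺; ∈-map⁻; ∈-concat⁺′; ∈-concat⁻′; ∈-upTo⁺; ∈-upTo⁻)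
open import Data.List.Membership.DecPropositional _≟_ using (_∈?_; _∉?_)
open import Data.List.Relation.Binary.Subset.Propositional using (_⊆_)
open import Data.List.Relation.Binary.Subset.Propositional.Properties
  using (⊆-reflexive; ⊆-refl; ⊆-trans; xs⊆xs++ys; ++⁺; ++⁺ʳ; filter-⊆)
open import Data.List.Relation.Unary.Any using (here; there)
import Data.List.Relation.Unary.All as All
open import Data.List.Relation.Unary.AllPairs using (_∷_)
open import Data.List.Relation.Unary.Unique.Propositional using (Unique)
import Data.List.Relation.Unary.Unique.Propositional.Properties as Unique
open import Data.List.Relation.Unary.Unique.DecPropositional.Properties _≟_ using (deduplicate-!)
open import Data.Product using (_×_; _,_; ∃-syntax; proj₁; proj₂)
open import Data.Sum using (inj₁; inj₂)
open import Data.Empty using (⊥-elim)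
open import Relation.Nullary using (yes; no)
open import Relation.Binary.PropositionalEquality hiding ([_])
open import Algebra.Properties.CommutativeSemigroup +-commutativeSemigroup using (x∙yz≈y∙xz)
open import Function.Base using (_∘_)
open import Function.Bundles using (_⇔_; mk⇔; Equivalence)
open import Function.Construct.Composition using (_⇔-∘_)

-- Cardinality of finite sets

module _ {A : Set} where

  sum-map-++ : (f : A → ℕ) (xs ys : List A) → sum (map f (xs ++ ys)) ≡ sum (map f xs) + sum (map f ys)
  sum-map-++ f xs ys = trans (cong sum (map-++ f xs ys)) (sum-++ (map f xs) (map f ys))

  sum-map-mono : (f : A → ℕ) {U V : List A} → Unique U → U ⊆ V → sum (map f U) ≤ sum (map f V)
  sum-map-mono f {[]} _ _ = z≤n
  sum-map-mono f {x ∷ U} (x∉U ∷ U!) U⊆V with ys , zs , refl ← ∈-∃++ (U⊆V (here refl)) =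
    begin
      f x + sum (map f U)                      ≤⟨ +-monoʳ-≤ (f x) (sum-map-mono f U! U⊆ys++zs) ⟩
      f x + sum (map f (ys ++ zs))             ≡⟨ cong (f x +_) (sum-map-++ f ys zs) ⟩
      f x + (sum (map f ys) + sum (map f zs))  ≡⟨ x∙yz≈y∙xz (f x) (sum (map f ys)) (sum (map f zs)) ⟩
      sum (map f ys) + (f x + sum (map f zs))  ≡⟨ sum-map-++ f ys (x ∷ zs) ⟨
      sum (map f (ys ++ x ∷ zs))               ∎
    where
    open ≤-Reasoning
    U⊆ys++zs : U ⊆ ys ++ zs
    U⊆ys++zs {y} y∈U with ∈-++⁻ ys (U⊆V (there y∈U))
    ... | inj₁ y∈ys         = ∈-++⁺ˡ y∈ys
    ... | inj₂ (here refl)  = ⊥-elim (All.lookup x∉U y∈U refl)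
    ... | inj₂ (there y∈zs) = ∈-++⁺ʳ ys y∈zs

  sum-map-cong : (f : A → ℕ) {U V : List A} → Unique U → Unique V → U ⊆ V → V ⊆ U →
                 sum (map f U) ≡ sum (map f V)
  sum-map-cong f U! V! U⊆V V⊆U = ≤-antisym (sum-map-mono f U! U⊆V) (sum-map-mono f V! V⊆U)

  length-mono : {U V : List A} → Unique U → U ⊆ V → length U ≤ length V
  length-mono {U} {V} U! U⊆V =
    subst₂ _≤_ (length≡sum U) (length≡sum V) (sum-map-mono (λ _ → 1) U! U⊆V)
    where
    length≡sum : ∀ xs → sum (map (λ _ → 1) xs) ≡ length xs
    length≡sum []       = refl
    length≡sum (_ ∷ xs) = cong suc (length≡sum xs)

dedup : FinSet → FinSet
dedup = deduplicate _≟_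

dedup⊆ : ∀ A → dedup A ⊆ A
dedup⊆ A = ∈-deduplicate⁻ _≟_ A

⊆dedup : ∀ A → A ⊆ dedup A
⊆dedup A = ∈-deduplicate⁺ _≟_

card-mono : ∀ {A B} → A ⊆ B → card A ≤ card B
card-mono {A} {B} A⊆B = length-mono (deduplicate-! A) (⊆-trans (dedup⊆ A) (⊆-trans A⊆B (⊆dedup B)))

card-cong : ∀ {A B} → A ⊆ B → B ⊆ A → card A ≡ card B
card-cong A⊆B B⊆A = ≤-antisym (card-mono A⊆B) (card-mono B⊆A)

card≤length : ∀ A → card A ≤ length A
card≤length A = length-mono (deduplicate-! A) (dedup⊆ A)

card-unique : ∀ {A} → Unique A → card A ≡ length A
card-unique {A} A! = ≤-antisym (card≤length A) (length-mono A! (⊆dedup A))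

card-++-≤ : ∀ A B → card (A ++ B) ≤ card A + card B
card-++-≤ A B = begin
  card (A ++ B)               ≤⟨ card-mono (++⁺ (⊆dedup A) (⊆dedup B)) ⟩
  card (dedup A ++ dedup B)   ≤⟨ card≤length (dedup A ++ dedup B) ⟩
  length (dedup A ++ dedup B) ≡⟨ length-++ (dedup A) ⟩
  card A + card B             ∎
  where open ≤-Reasoning

card-++-disjoint : ∀ {A B} → Disjoint A B → card (A ++ B) ≡ card A + card B
card-++-disjoint {A} {B} A#B = ≤-antisym (card-++-≤ A B) (begin
  card A + card B             ≡⟨ length-++ (dedup A) ⟨
  length (dedup A ++ dedup B) ≡⟨ card-unique dedupA++dedupB! ⟨
  card (dedup A ++ dedup B)   ≤⟨ card-mono (++⁺ (dedup⊆ A) (dedup⊆ B)) ⟩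
  card (A ++ B)               ∎)
  where
  open ≤-Reasoning
  dedupA++dedupB! : Unique (dedup A ++ dedup B)
  dedupA++dedupB! = Unique.++⁺ (deduplicate-! A) (deduplicate-! B)
                      (λ (x∈A , x∈B) → A#B _ (dedup⊆ A x∈A) (dedup⊆ B x∈B))

subset-of-card : ∀ {k} A → k ≤ card A → ∃[ C ] C ⊆ A × card C ≡ k
subset-of-card {k} A k≤card = C , C⊆A , card-C
  where
  C : FinSet
  C = take k (dedup A)
  C⊆A : C ⊆ A
  C⊆A = ⊆-trans (xs⊆xs++ys C (drop k (dedup A)))
          (⊆-trans (⊆-reflexive (take++drop≡id k (dedup A))) (dedup⊆ A))
  card-C : card C ≡ k
  card-C = trans (card-unique (Unique.take⁺ k (deduplicate-! A)))
                 (trans (length-take k (dedup A)) (m≤n⇒m⊓n≡m k≤card))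

-- Paths with lists and weights indexed by ℕ, where the induction can shorten the path

unionUpTo : (ℕ → FinSet) → ℕ → FinSet
unionUpTo L zero    = L zero
unionUpTo L (suc t) = unionUpTo L t ++ L (suc t)

sumUpTo : (ℕ → ℕ) → ℕ → ℕ
sumUpTo w zero    = w zero
sumUpTo w (suc t) = sumUpTo w t + w (suc t)

∈-unionUpTo⁺ : ∀ L {t a x} → a ≤ t → x ∈ L a → x ∈ unionUpTo L t
∈-unionUpTo⁺ L {zero}  z≤n x∈La = x∈La
∈-unionUpTo⁺ L {suc t} a≤1+t x∈La with m≤n⇒m<n∨m≡n a≤1+t
... | inj₁ a<1+t = ∈-++⁺ˡ (∈-unionUpTo⁺ L (≤-pred a<1+t) x∈La)
... | inj₂ refl  = ∈-++⁺ʳ (unionUpTo L t) x∈La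

∈-unionUpTo⁻ : ∀ L t {x} → x ∈ unionUpTo L t → ∃[ a ] a ≤ t × x ∈ L a
∈-unionUpTo⁻ L zero    x∈L0 = zero , z≤n , x∈L0
∈-unionUpTo⁻ L (suc t) x∈U with ∈-++⁻ (unionUpTo L t) x∈U
... | inj₂ x∈L[1+t] = suc t , ≤-refl , x∈L[1+t]
... | inj₁ x∈Ut with a , a≤t , x∈La ← ∈-unionUpTo⁻ L t x∈Ut = a , m≤n⇒m≤1+n a≤t , x∈La

unionUpTo-mono : ∀ {L L′ t} → (∀ {a} → a ≤ t → L a ⊆ L′ a) → unionUpTo L t ⊆ unionUpTo L′ t
unionUpTo-mono {L} {L′} {t} L⊆L′ x∈U with a , a≤t , x∈La ← ∈-unionUpTo⁻ L t x∈U =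
  ∈-unionUpTo⁺ L′ a≤t (L⊆L′ a≤t x∈La)

Waterfallℕ : ℕ → (ℕ → FinSet) → Set
Waterfallℕ n L = ∀ {a b} → b ≤ n → suc a < b → Disjoint (L a) (L b)

InteriorCapacity : ℕ → (ℕ → FinSet) → (ℕ → ℕ) → Set
InteriorCapacity n L w = ∀ {a} → 1 ≤ a → a < n → w a + w (suc a) ≤ card (L a)

PrefixCondition : ℕ → (ℕ → FinSet) → (ℕ → ℕ) → Set
PrefixCondition n L w = ∀ {t} → t ≤ n → sumUpTo w t ≤ card (unionUpTo L t)

IsColoringℕ : ℕ → (ℕ → FinSet) → (ℕ → ℕ) → (ℕ → FinSet) → Set
IsColoringℕ n L w c =
  (∀ {a} → a ≤ n → c a ⊆ L a) ×
  (∀ {a} → a ≤ n → card (c a) ≡ w a) ×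
  (∀ {a} → a < n → Disjoint (c a) (c (suc a)))

Colorableℕ : ℕ → (ℕ → FinSet) → (ℕ → ℕ) → Set
Colorableℕ n L w = ∃[ c ] IsColoringℕ n L w c

coloring-disjoint-from-earlier : ∀ {n L w c t} → Waterfallℕ n L → IsColoringℕ n L w c →
                                 suc t ≤ n → Disjoint (unionUpTo c t) (c (suc t))
coloring-disjoint-from-earlier {c = c} {t} wf (c⊆L , _ , adjacent) 1+t≤n x x∈U x∈c[1+t]
  with a , a≤t , x∈ca ← ∈-unionUpTo⁻ c t x∈U with m≤n⇒m<n∨m≡n a≤t
... | inj₁ a<t  = wf 1+t≤n (s≤s a<t) x (c⊆L (≤-trans a≤t (<⇒≤ 1+t≤n)) x∈ca) (c⊆L 1+t≤n x∈c[1+t])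
... | inj₂ refl = adjacent 1+t≤n x x∈ca x∈c[1+t]

card-unionUpTo-coloring : ∀ {n L w c t} → Waterfallℕ n L → IsColoringℕ n L w c →
                          t ≤ n → card (unionUpTo c t) ≡ sumUpTo w t
card-unionUpTo-coloring {t = zero}  wf (_ , card-c , _) _ = card-c z≤n
card-unionUpTo-coloring {t = suc t} wf coloring@(_ , card-c , _) 1+t≤n =
  trans (card-++-disjoint (coloring-disjoint-from-earlier wf coloring 1+t≤n))
        (cong₂ _+_ (card-unionUpTo-coloring wf coloring (<⇒≤ 1+t≤n)) (card-c 1+t≤n))

colorable⇒prefixCondition : ∀ {n L w} → Waterfallℕ n L → Colorableℕ n L w → PrefixCondition n L w
colorable⇒prefixCondition {L = L} {w} wf (c , coloring@(c⊆L , _ , _)) {t} t≤n = begin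
  sumUpTo w t            ≡⟨ card-unionUpTo-coloring wf coloring t≤n ⟨
  card (unionUpTo c t)   ≤⟨ card-mono (unionUpTo-mono (λ a≤t → c⊆L (≤-trans a≤t t≤n))) ⟩
  card (unionUpTo L t)   ∎
  where open ≤-Reasoning

_∖_ : (ℕ → FinSet) → FinSet → ℕ → FinSet
(L ∖ X) a = filter (_∉? X) (L a)

∖⊆ : ∀ L X {a} → (L ∖ X) a ⊆ L a
∖⊆ L X {a} = filter-⊆ (_∉? X) (L a)

∖-disjoint : ∀ L X {a} → Disjoint ((L ∖ X) a) X
∖-disjoint L X {a} _ x∈L∖X = proj₂ (∈-filter⁻ (_∉? X) {xs = L a} x∈L∖X)

∈-∖⁺ : ∀ L X {a x} → x ∈ L a → x ∉ X → x ∈ (L ∖ X) a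
∈-∖⁺ L X = ∈-filter⁺ (_∉? X)

⊆∖++ : ∀ L X {a} → L a ⊆ (L ∖ X) a ++ X
⊆∖++ L X {a} {x} x∈La with x ∈? X
... | yes x∈X = ∈-++⁺ʳ ((L ∖ X) a) x∈X
... | no  x∉X = ∈-++⁺ˡ (∈-∖⁺ L X x∈La x∉X)

unionUpTo-∖ : ∀ L X {F C} t → X ⊆ F ++ C → Disjoint F (unionUpTo L t) →
              unionUpTo L t ⊆ unionUpTo (L ∖ X) t ++ C
unionUpTo-∖ L X {F} {C} t X⊆F++C F#U {x} x∈U with x ∈? X
... | yes x∈X with ∈-++⁻ F (X⊆F++C x∈X)
...   | inj₁ x∈F = ⊥-elim (F#U x x∈F x∈U)
...   | inj₂ x∈C = ∈-++⁺ʳ (unionUpTo (L ∖ X) t) x∈C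
unionUpTo-∖ L X t _ _ x∈U | no x∉X
  with a , a≤t , x∈La ← ∈-unionUpTo⁻ L t x∈U = ∈-++⁺ˡ (∈-unionUpTo⁺ (L ∖ X) a≤t (∈-∖⁺ L X x∈La x∉X))

module ColourChoice {m L} (wf : Waterfallℕ (suc m) L) where

  fresh shared : FinSet
  fresh  = filter (_∉? L m) (L (suc m))
  shared = filter (_∈? L m) (L (suc m))

  ∈-fresh⁻ : ∀ {x} → x ∈ fresh → x ∈ L (suc m) × x ∉ L m
  ∈-fresh⁻ = ∈-filter⁻ (_∉? L m) {xs = L (suc m)}

  ∈-shared⁻ : ∀ {x} → x ∈ shared → x ∈ L (suc m) × x ∈ L m
  ∈-shared⁻ = ∈-filter⁻ (_∈? L m) {xs = L (suc m)}

  fresh-disjoint : Disjoint fresh (unionUpTo L m)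
  fresh-disjoint x x∈fresh x∈U with x∈L[1+m] , x∉Lm ← ∈-fresh⁻ x∈fresh
    with a , a≤m , x∈La ← ∈-unionUpTo⁻ L m x∈U with m≤n⇒m<n∨m≡n a≤m
  ... | inj₁ a<m  = wf ≤-refl (s≤s a<m) x x∈La x∈L[1+m]
  ... | inj₂ refl = x∉Lm x∈La

  fresh-shared-disjoint : Disjoint fresh shared
  fresh-shared-disjoint x x∈fresh x∈shared =
    proj₂ (∈-fresh⁻ x∈fresh) (proj₂ (∈-shared⁻ x∈shared))

  L[1+m]⊆fresh++shared : L (suc m) ⊆ fresh ++ shared
  L[1+m]⊆fresh++shared {x} x∈L[1+m] with x ∈? L m
  ... | yes x∈Lm = ∈-++⁺ʳ fresh (∈-filter⁺ (_∈? L m) x∈L[1+m] x∈Lm)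
  ... | no  x∉Lm = ∈-++⁺ˡ (∈-filter⁺ (_∉? L m) x∈L[1+m] x∉Lm)

  unionUpTo-suc⊆ : unionUpTo L (suc m) ⊆ unionUpTo L m ++ fresh
  unionUpTo-suc⊆ {x} x∈U with ∈-++⁻ (unionUpTo L m) x∈U
  ... | inj₁ x∈Um = ∈-++⁺ˡ x∈Um
  ... | inj₂ x∈L[1+m] with ∈-++⁻ fresh (L[1+m]⊆fresh++shared x∈L[1+m])
  ...   | inj₁ x∈fresh  = ∈-++⁺ʳ (unionUpTo L m) x∈fresh
  ...   | inj₂ x∈shared = ∈-++⁺ˡ (∈-unionUpTo⁺ L ≤-refl (proj₂ (∈-shared⁻ x∈shared)))

  fresh++shared⊆L[1+m] : fresh ++ shared ⊆ L (suc m)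
  fresh++shared⊆L[1+m] x∈X with ∈-++⁻ fresh x∈X
  ... | inj₁ x∈fresh  = proj₁ (∈-fresh⁻ x∈fresh)
  ... | inj₂ x∈shared = proj₁ (∈-shared⁻ x∈shared)

  ∸fresh≤shared : ∀ {k} → k ≤ card (L (suc m)) → k ∸ card fresh ≤ card shared
  ∸fresh≤shared {k} k≤card = begin
    k ∸ card fresh                        ≤⟨ ∸-monoˡ-≤ (card fresh) k≤card ⟩
    card (L (suc m)) ∸ card fresh         ≤⟨ ∸-monoˡ-≤ (card fresh) (card-mono L[1+m]⊆fresh++shared) ⟩
    card (fresh ++ shared) ∸ card fresh   ≤⟨ ∸-monoˡ-≤ (card fresh) (card-++-≤ fresh shared) ⟩
    card fresh + card shared ∸ card fresh ≡⟨ m+n∸m≡n (card fresh) (card shared) ⟩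
    card shared                           ∎
    where open ≤-Reasoning

  ExtendableChoice : (ℕ → ℕ) → Set
  ExtendableChoice w = ∃[ X ] X ⊆ L (suc m) × card X ≡ w (suc m) × sumUpTo w m ≤ card (unionUpTo (L ∖ X) m)

  choice-within-fresh : ∀ {w} → w (suc m) ≤ card fresh → sumUpTo w m ≤ card (unionUpTo L m) → ExtendableChoice w
  choice-within-fresh {w} w≤fresh prefix[m] with X , X⊆fresh , |X| ← subset-of-card fresh w≤fresh =
    X , ⊆-trans X⊆fresh (⊆-trans (xs⊆xs++ys fresh shared) fresh++shared⊆L[1+m]) , |X| , (begin
      sumUpTo w m                       ≤⟨ prefix[m] ⟩
      card (unionUpTo L m)              ≤⟨ card-mono (unionUpTo-∖ L X m (⊆-trans X⊆fresh (xs⊆xs++ys fresh [])) fresh-disjoint) ⟩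
      card (unionUpTo (L ∖ X) m ++ [])  ≡⟨ cong card (++-identityʳ (unionUpTo (L ∖ X) m)) ⟩
      card (unionUpTo (L ∖ X) m)        ∎)
    where open ≤-Reasoning

  choice-exhausting-fresh : ∀ {w} → card fresh ≤ w (suc m) → w (suc m) ≤ card (L (suc m)) →
                            sumUpTo w (suc m) ≤ card (unionUpTo L (suc m)) → ExtendableChoice w
  choice-exhausting-fresh {w} fresh≤w room prefix[1+m]
    with C , C⊆shared , |C| ← subset-of-card shared (∸fresh≤shared room) =
    X , ⊆-trans (++⁺ʳ fresh C⊆shared) fresh++shared⊆L[1+m] , |X| , +-cancelʳ-≤ k _ _ (begin
      sumUpTo w m + k                             ≤⟨ prefix[1+m] ⟩
      card (unionUpTo L (suc m))                  ≤⟨ card-mono unionUpTo-suc⊆ ⟩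
      card (unionUpTo L m ++ fresh)               ≤⟨ card-++-≤ (unionUpTo L m) fresh ⟩
      card (unionUpTo L m) + card fresh           ≤⟨ +-monoˡ-≤ (card fresh) (card-mono (unionUpTo-∖ L X m ⊆-refl fresh-disjoint)) ⟩
      card (U′ ++ C) + card fresh                 ≤⟨ +-monoˡ-≤ (card fresh) (card-++-≤ U′ C) ⟩
      card U′ + card C + card fresh               ≡⟨ +-assoc (card U′) (card C) (card fresh) ⟩
      card U′ + (card C + card fresh)             ≡⟨ cong (λ z → card U′ + (z + card fresh)) |C| ⟩
      card U′ + (k ∸ card fresh + card fresh)     ≡⟨ cong (card U′ +_) (m∸n+n≡m fresh≤w) ⟩
      card U′ + k                                 ∎)
    where
    open ≤-Reasoning
    k : ℕ
    k = w (suc m)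
    X U′ : FinSet
    X = fresh ++ C
    U′ = unionUpTo (L ∖ X) m
    |X| : card X ≡ k
    |X| = begin-equality
      card (fresh ++ C)               ≡⟨ card-++-disjoint {fresh} {C} (λ x x∈fresh x∈C → fresh-shared-disjoint x x∈fresh (C⊆shared x∈C)) ⟩
      card fresh + card C             ≡⟨ cong (card fresh +_) |C| ⟩
      card fresh + (k ∸ card fresh)   ≡⟨ m+[n∸m]≡n fresh≤w ⟩
      k                               ∎

  colour-choice : ∀ {w} → w (suc m) ≤ card (L (suc m)) → PrefixCondition (suc m) L w → ExtendableChoice w
  colour-choice {w} room prefix with w (suc m) ≤? card fresh
  ... | yes w≤fresh = choice-within-fresh w≤fresh (prefix (n≤1+n m))
  ... | no  w≰fresh = choice-exhausting-fresh (<⇒≤ (≰⇒> w≰fresh)) room (prefix ≤-refl)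

module Removal {m L X} (wf : Waterfallℕ (suc m) L) (X⊆L[1+m] : X ⊆ L (suc m)) where

  below-unchanged : ∀ {a} → a < m → L a ⊆ (L ∖ X) a
  below-unchanged a<m {x} x∈La = ∈-∖⁺ L X x∈La (λ x∈X → wf ≤-refl (s≤s a<m) x x∈La (X⊆L[1+m] x∈X))

  waterfall : Waterfallℕ m (L ∖ X)
  waterfall b≤m 1+a<b x x∈L∖Xa x∈L∖Xb =
    wf (m≤n⇒m≤1+n b≤m) 1+a<b x (∖⊆ L X x∈L∖Xa) (∖⊆ L X x∈L∖Xb)

  interior-capacity : ∀ {w} → InteriorCapacity (suc m) L w → InteriorCapacity m (L ∖ X) w
  interior-capacity interior 1≤a a<m =
    ≤-trans (interior 1≤a (m<n⇒m<1+n a<m)) (card-mono (below-unchanged a<m))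

  prefix-condition : ∀ {w} → PrefixCondition (suc m) L w → sumUpTo w m ≤ card (unionUpTo (L ∖ X) m) →
                     PrefixCondition m (L ∖ X) w
  prefix-condition prefix prefix[m] t≤m with m≤n⇒m<n∨m≡n t≤m
  ... | inj₂ refl = prefix[m]
  ... | inj₁ t<m  = ≤-trans (prefix (m≤n⇒m≤1+n t≤m))
                      (card-mono (unionUpTo-mono (λ a≤t → below-unchanged (≤-<-trans a≤t t<m))))

last-vertex-room : ∀ m L X {w} → InteriorCapacity (suc m) L w → card X ≡ w (suc m) →
                   sumUpTo w m ≤ card (unionUpTo (L ∖ X) m) → w m ≤ card ((L ∖ X) m)
last-vertex-room zero    _ _     _        _   prefix[0] = prefix[0]
last-vertex-room (suc m) L X {w} interior |X| _         = +-cancelʳ-≤ (w (suc (suc m))) _ _ (begin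
  w (suc m) + w (suc (suc m))               ≤⟨ interior (s≤s z≤n) ≤-refl ⟩
  card (L (suc m))                          ≤⟨ card-mono (⊆∖++ L X) ⟩
  card ((L ∖ X) (suc m) ++ X)               ≤⟨ card-++-≤ ((L ∖ X) (suc m)) X ⟩
  card ((L ∖ X) (suc m)) + card X           ≡⟨ cong (card ((L ∖ X) (suc m)) +_) |X| ⟩
  card ((L ∖ X) (suc m)) + w (suc (suc m))  ∎)
  where open ≤-Reasoning

_[_]≔_ : (ℕ → FinSet) → ℕ → FinSet → ℕ → FinSet
(c [ n ]≔ X) a with a ≟ n
... | yes _ = X
... | no  _ = c a

coloring-extend : ∀ {m L w c X} → IsColoringℕ m (L ∖ X) w c → X ⊆ L (suc m) → card X ≡ w (suc m) →
                  IsColoringℕ (suc m) L w (c [ suc m ]≔ X)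
coloring-extend {m} {L} {w} {c} {X} (c⊆L∖X , card-c , adjacent) X⊆L[1+m] |X| = c′⊆L , card-c′ , adjacent′
  where
  c′⊆L : ∀ {a} → a ≤ suc m → (c [ suc m ]≔ X) a ⊆ L a
  c′⊆L {a} a≤1+m with a ≟ suc m
  ... | yes refl  = X⊆L[1+m]
  ... | no  a≢1+m = ⊆-trans (c⊆L∖X (≤-pred (≤∧≢⇒< a≤1+m a≢1+m))) (∖⊆ L X)
  card-c′ : ∀ {a} → a ≤ suc m → card ((c [ suc m ]≔ X) a) ≡ w a
  card-c′ {a} a≤1+m with a ≟ suc m
  ... | yes refl  = |X|
  ... | no  a≢1+m = card-c (≤-pred (≤∧≢⇒< a≤1+m a≢1+m))
  adjacent′ : ∀ {a} → a < suc m → Disjoint ((c [ suc m ]≔ X) a) ((c [ suc m ]≔ X) (suc a))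
  adjacent′ {a} a<1+m with a ≟ suc m | suc a ≟ suc m
  ... | yes refl | _             = ⊥-elim (<-irrefl refl a<1+m)
  ... | no _     | yes refl      = λ x x∈cm → ∖-disjoint L X x (c⊆L∖X ≤-refl x∈cm)
  ... | no _     | no 1+a≢1+m    = adjacent (≤∧≢⇒< (≤-pred a<1+m) (1+a≢1+m ∘ cong suc))

prefixCondition⇒colorable : ∀ n {L w} → Waterfallℕ n L → InteriorCapacity n L w → w n ≤ card (L n) →
                            PrefixCondition n L w → Colorableℕ n L w
prefixCondition⇒colorable zero {L} {w} _ _ room _ with C , C⊆L0 , |C| ← subset-of-card (L 0) room =
  (λ _ → C) , (λ { z≤n → C⊆L0 }) , (λ { z≤n → |C| }) , λ ()
prefixCondition⇒colorable (suc m) {L} {w} wf interior room prefix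
  with X , X⊆L[1+m] , |X| , prefix[m] ← ColourChoice.colour-choice wf room prefix =
  let open Removal wf X⊆L[1+m]
      c , coloring = prefixCondition⇒colorable m waterfall (interior-capacity {w} interior)
                       (last-vertex-room m L X interior |X| prefix[m]) (prefix-condition prefix prefix[m])
  in c [ suc m ]≔ X , coloring-extend coloring X⊆L[1+m] |X|

colorableℕ⇔prefixCondition : ∀ n {L w} → Waterfallℕ n L → InteriorCapacity n L w → w n ≤ card (L n) →
                              Colorableℕ n L w ⇔ PrefixCondition n L w
colorableℕ⇔prefixCondition n wf interior room =
  mk⇔ (colorable⇒prefixCondition wf) (prefixCondition⇒colorable n wf interior room)

-- Transfer to the path with vertex set Fin (suc n)

-- Indices above n give junk vertices, which are never used.
vertex : ∀ n → ℕ → Fin (suc n)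
vertex n a = a mod suc n

toℕ-vertex : ∀ {n a} → a ≤ n → toℕ (vertex n a) ≡ a
toℕ-vertex a≤n = trans (toℕ-fromℕ< _) (m≤n⇒m%n≡m a≤n)

vertex-toℕ : ∀ {n} (k : Fin (suc n)) → vertex n (toℕ k) ≡ k
vertex-toℕ k = toℕ-injective (toℕ-vertex (toℕ≤pred[n] k))

vertex-inject₁ : ∀ {n a} (a<n : a < n) → vertex n a ≡ inject₁ (fromℕ< a<n)
vertex-inject₁ a<n = toℕ-injective (trans (toℕ-vertex (<⇒≤ a<n)) (sym (trans (toℕ-inject₁ _) (toℕ-fromℕ< a<n))))

vertex-suc : ∀ {n a} (a<n : a < n) → vertex n (suc a) ≡ Data.Fin.suc (fromℕ< a<n)
vertex-suc a<n = toℕ-injective (trans (toℕ-vertex a<n) (sym (cong suc (toℕ-fromℕ< a<n))))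

vertex-last : ∀ n → vertex n n ≡ fromℕ n
vertex-last n = toℕ-injective (trans (toℕ-vertex ≤-refl) (sym (toℕ-fromℕ n)))

1+m<n⇒2≤∣m-n∣ : ∀ {m n} → suc m < n → 2 ≤ ∣ m - n ∣
1+m<n⇒2≤∣m-n∣ {zero}          2≤n         = 2≤n
1+m<n⇒2≤∣m-n∣ {suc m} {suc n} (s≤s 1+m<n) = 1+m<n⇒2≤∣m-n∣ 1+m<n

waterfallℕ : ∀ {n} (L : Lists n) → Waterfall n L → Waterfallℕ n (L ∘ vertex n)
waterfallℕ {n} L wf {a} {b} b≤n 1+a<b =
  wf (vertex n a) (vertex n b)
     (subst₂ (λ u v → 2 ≤ ∣ u - v ∣) (sym (toℕ-vertex a≤n)) (sym (toℕ-vertex b≤n)) (1+m<n⇒2≤∣m-n∣ 1+a<b))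
  where
  a≤n : a ≤ n
  a≤n = ≤-trans (≤-trans (n≤1+n a) (<⇒≤ 1+a<b)) b≤n

module _ {n} (L : Lists n) (w : Weights n) where

  interior-capacityℕ : (∀ (i : Fin n) → 1 ≤ toℕ i → w (inject₁ i) + w (Data.Fin.suc i) ≤ card (L (inject₁ i))) →
                       InteriorCapacity n (L ∘ vertex n) (w ∘ vertex n)
  interior-capacityℕ interior {a} 1≤a a<n =
    subst₂ (λ u v → w u + w v ≤ card (L u)) (sym (vertex-inject₁ a<n)) (sym (vertex-suc a<n))
      (interior (fromℕ< a<n) (subst (1 ≤_) (sym (toℕ-fromℕ< a<n)) 1≤a))

  last-capacityℕ : w (fromℕ n) ≤ card (L (fromℕ n)) → w (vertex n n) ≤ card (L (vertex n n))
  last-capacityℕ = subst (λ v → w v ≤ card (L v)) (sym (vertex-last n))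

  colorable⇔colorableℕ : Colorable n L w ⇔ Colorableℕ n (L ∘ vertex n) (w ∘ vertex n)
  colorable⇔colorableℕ = mk⇔ to from
    where
    to : Colorable n L w → Colorableℕ n (L ∘ vertex n) (w ∘ vertex n)
    to (c , c⊆L , card-c , adjacent) =
      c ∘ vertex n , (λ {a} _ → c⊆L (vertex n a) _) , (λ _ → card-c _) ,
      λ a<n → subst₂ (λ u v → Disjoint (c u) (c v)) (sym (vertex-inject₁ a<n)) (sym (vertex-suc a<n))
                (adjacent (fromℕ< a<n))
    from : Colorableℕ n (L ∘ vertex n) (w ∘ vertex n) → Colorable n L w
    from (c , c⊆L , card-c , adjacent) =
      c ∘ toℕ ,
      (λ k x x∈c → subst (λ v → x ∈ L v) (vertex-toℕ k) (c⊆L (toℕ≤pred[n] k) x∈c)) ,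
      (λ k → trans (card-c (toℕ≤pred[n] k)) (cong w (vertex-toℕ k))) ,
      λ i → subst (λ u → Disjoint (c u) (c (suc (toℕ i)))) (sym (toℕ-inject₁ i)) (adjacent (toℕ<n i))

sumUpTo≡sum-upTo : ∀ w t → sumUpTo w t ≡ sum (map w (upTo (suc t)))
sumUpTo≡sum-upTo w zero    = sym (+-identityʳ (w zero))
sumUpTo≡sum-upTo w (suc t) = begin
  sumUpTo w t + w (suc t)                           ≡⟨ cong (_+ w (suc t)) (sumUpTo≡sum-upTo w t) ⟩
  sum (map w (upTo (suc t))) + w (suc t)            ≡⟨ cong (sum (map w (upTo (suc t))) +_) (+-identityʳ (w (suc t))) ⟨
  sum (map w (upTo (suc t))) + sum (map w [ suc t ]) ≡⟨ sum-map-++ w (upTo (suc t)) [ suc t ] ⟨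
  sum (map w (upTo (suc t) ++ [ suc t ]))           ≡⟨ cong (sum ∘ map w) (upTo-∷ʳ (suc t)) ⟩
  sum (map w (upTo (suc (suc t))))                  ∎
  where open ≡-Reasoning

module _ {n} (j : Fin (suc n)) where

  ∈-upToV⁺ : ∀ {k} → toℕ k ≤ toℕ j → k ∈ upToV n j
  ∈-upToV⁺ {k} = ∈-filter⁺ (λ k → toℕ k ≤? toℕ j) (∈-allFin k)

  ∈-upToV⁻ : ∀ {k} → k ∈ upToV n j → toℕ k ≤ toℕ j
  ∈-upToV⁻ k∈V = proj₂ (∈-filter⁻ (λ k → toℕ k ≤? toℕ j) {xs = allFin (suc n)} k∈V)

  map-toℕ-upToV⊆upTo : map toℕ (upToV n j) ⊆ upTo (suc (toℕ j))
  map-toℕ-upToV⊆upTo a∈ with k , k∈V , refl ← ∈-map⁻ toℕ a∈ = ∈-upTo⁺ (s≤s (∈-upToV⁻ k∈V))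

  vertex∈upToV : ∀ {a} → a ≤ toℕ j → vertex n a ∈ upToV n j
  vertex∈upToV a≤j = ∈-upToV⁺ (subst (_≤ toℕ j) (sym (toℕ-vertex (≤-trans a≤j (toℕ≤pred[n] j)))) a≤j)

  upTo⊆map-toℕ-upToV : upTo (suc (toℕ j)) ⊆ map toℕ (upToV n j)
  upTo⊆map-toℕ-upToV a∈ with a≤j ← ≤-pred (∈-upTo⁻ a∈) =
    subst (_∈ map toℕ (upToV n j)) (toℕ-vertex (≤-trans a≤j (toℕ≤pred[n] j))) (∈-map⁺ toℕ (vertex∈upToV a≤j))

  prefixWeight≡sumUpTo : (w : Weights n) → prefixWeight n w j ≡ sumUpTo (w ∘ vertex n) (toℕ j)
  prefixWeight≡sumUpTo w = begin
    sum (map w (upToV n j))                              ≡⟨ cong sum (map-cong (λ k → cong w (vertex-toℕ k)) (upToV n j)) ⟨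
    sum (map (w ∘ vertex n ∘ toℕ) (upToV n j))           ≡⟨ cong sum (map-∘ (upToV n j)) ⟩
    sum (map (w ∘ vertex n) (map toℕ (upToV n j)))       ≡⟨ sum-map-cong (w ∘ vertex n) map-toℕ-upToV! (Unique.upTo⁺ _)
                                                               map-toℕ-upToV⊆upTo upTo⊆map-toℕ-upToV ⟩
    sum (map (w ∘ vertex n) (upTo (suc (toℕ j))))        ≡⟨ sumUpTo≡sum-upTo (w ∘ vertex n) (toℕ j) ⟨
    sumUpTo (w ∘ vertex n) (toℕ j)                       ∎
    where
    open ≡-Reasoning
    map-toℕ-upToV! : Unique (map toℕ (upToV n j))
    map-toℕ-upToV! = Unique.map⁺ toℕ-injective (Unique.filter⁺ (λ k → toℕ k ≤? toℕ j) (Unique.allFin⁺ (suc n)))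

  card-prefixUnion≡card-unionUpTo : (L : Lists n) →
                                    card (prefixUnion n L j) ≡ card (unionUpTo (L ∘ vertex n) (toℕ j))
  card-prefixUnion≡card-unionUpTo L = card-cong prefix⊆union union⊆prefix
    where
    prefix⊆union : prefixUnion n L j ⊆ unionUpTo (L ∘ vertex n) (toℕ j)
    prefix⊆union {x} x∈ with ys , x∈ys , ys∈ ← ∈-concat⁻′ (map L (upToV n j)) x∈
                           with k , k∈V , refl ← ∈-map⁻ L ys∈ =
      ∈-unionUpTo⁺ (L ∘ vertex n) (∈-upToV⁻ k∈V) (subst (λ v → x ∈ L v) (sym (vertex-toℕ k)) x∈ys)
    union⊆prefix : unionUpTo (L ∘ vertex n) (toℕ j) ⊆ prefixUnion n L j
    union⊆prefix x∈ with a , a≤j , x∈La ← ∈-unionUpTo⁻ (L ∘ vertex n) (toℕ j) x∈ =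
      ∈-concat⁺′ x∈La (∈-map⁺ L (vertex∈upToV a≤j))

prefixCondition⇔prefix : ∀ n (L : Lists n) (w : Weights n) →
                         PrefixCondition n (L ∘ vertex n) (w ∘ vertex n) ⇔
                         (∀ j → prefixWeight n w j ≤ card (prefixUnion n L j))
prefixCondition⇔prefix n L w = mk⇔ to from
  where
  at : ∀ j → prefixWeight n w j ≤ card (prefixUnion n L j) ⇔
             sumUpTo (w ∘ vertex n) (toℕ j) ≤ card (unionUpTo (L ∘ vertex n) (toℕ j))
  at j = mk⇔ (subst₂ _≤_ (prefixWeight≡sumUpTo j w) (card-prefixUnion≡card-unionUpTo j L))
             (subst₂ _≤_ (sym (prefixWeight≡sumUpTo j w)) (sym (card-prefixUnion≡card-unionUpTo j L)))
  to : PrefixCondition n (L ∘ vertex n) (w ∘ vertex n) → ∀ j → prefixWeight n w j ≤ card (prefixUnion n L j)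
  to prefix j = Equivalence.from (at j) (prefix (toℕ≤pred[n] j))
  from : (∀ j → prefixWeight n w j ≤ card (prefixUnion n L j)) → PrefixCondition n (L ∘ vertex n) (w ∘ vertex n)
  from prefix {t} t≤n =
    subst (λ s → sumUpTo (w ∘ vertex n) s ≤ card (unionUpTo (L ∘ vertex n) s)) (toℕ-vertex t≤n)
      (Equivalence.to (at (vertex n t)) (prefix (vertex n t)))

corollary1 : (n : ℕ) → 1 ≤ n → (w : Weights n) → (L : Lists n) →
    Waterfall n L →
    (∀ (i : Fin n) → 1 ≤ toℕ i →
      w (inject₁ i) + w (Data.Fin.suc i) ≤ card (L (inject₁ i))) →
    w (fromℕ n) ≤ card (L (fromℕ n)) →
    Colorable n L w ⇔ (∀ (j : Fin (suc n)) → prefixWeight n w j ≤ card (prefixUnion n L j))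
corollary1 n _ w L waterfall interior room =
  prefixCondition⇔prefix n L w ⇔-∘
  (colorableℕ⇔prefixCondition n (waterfallℕ L waterfall) (interior-capacityℕ L w interior)
                                (last-capacityℕ L w room) ⇔-∘
   colorable⇔colorableℕ L w)
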